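{- Let $L$ be a finite lattice with at least three elements, with minimum $\hat0$ and maximum $\hat1$, and let $a,b\in L$ with $\hat0<a<b$. Then $$\sum_{\substack{x\in L\\ x\wedge a=\hat0}} J(x,b,\hat1)=0.$$
   Context: $J$ is defined on triples $x\le y\le z$ in $L$ by $\sum_{x\le a\le y\le b\le z} J(a,y,b)=\delta_3(x,y,z)$, where $\delta_3(x,y,z)=1$ if $x=y=z$ and $0$ otherwise; as usual for incidence functions, $J(x,y,z)$ is taken to be $0$ when $x\le y\le z$ fails (so only $x\le b$ contribute to the sum). -}

module Defs where

open import Data.Nat using (ℕ)
open import Data.Fin using (Fin)
open import Data.List using (List; map; foldr; allFin)
open import Data.Integer using (ℤ; _+_; 0ℤ; 1ℤ)
open import Data.Bool using (Bool; if_then_else_; _∧_)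
open import Relation.Nullary using (does; ¬_)
open import Relation.Binary using (Rel; Decidable)
open import Relation.Binary.PropositionalEquality using (_≡_)
open import Data.Product using (_×_)

ΣFin : (n : ℕ) → (Fin n → ℤ) → ℤ
ΣFin n f = foldr _+_ 0ℤ (map f (allFin n))

[_]·_ : Bool → ℤ → ℤ
[ b ]· v = if b then v else 0ℤ

δ₃ : {n : ℕ} → Fin n → Fin n → Fin n → ℤ
δ₃ x y z = [ does (x Data.Fin.≟ y) ∧ does (y Data.Fin.≟ z) ]· 1ℤ
  where import Data.Fin

-- These conditions determine J uniquely (triangular recursion on intervals).
record IsJ {n : ℕ} (_≤_ : Rel (Fin n) _) (_≤?_ : Decidable _≤_)
           (J : Fin n → Fin n → Fin n → ℤ) : Set where
  field
    J-zero : ∀ x y z → ¬ (x ≤ y × y ≤ z) → J x y z ≡ 0ℤ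
    J-sum  : ∀ x y z → x ≤ y → y ≤ z →
             ΣFin n (λ a → ΣFin n (λ b →
               [ does (x ≤? a) ∧ does (a ≤? y) ∧ does (y ≤? b) ∧ does (b ≤? z) ]·
                 J a y b))
             ≡ δ₃ x y z

module Submission where

-- J(c,c,-) and J(-,z,z) are the Möbius functions μ(c,-) and μ(-,z) of the order.
-- Writing the indicator of x ⊓ a = c as Σ_{y ⊑ x ⊓ a} μ(c,y), the down-set sums
-- Σ_{z ⊑ w} F(z) of F(z) = Σ_{x ⊓ a = c} J(x,b,z) become
-- Σ_{y ⊑ a} μ(c,y) Σ_{y ⊑ x, z ⊑ w} J(x,b,z) = Σ_{y ⊑ a} μ(c,y) δ₃(y,b,w),
-- which vanish because y ⊑ a ⊏ b forces y ≠ b; Möbius inversion then gives F = 0.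

open import Defs
open import Data.Nat using (ℕ; zero; suc; _≤_)
open import Data.Fin using (Fin; zero; suc)
open import Data.Fin.Properties using (_≟_)
open import Data.List using (foldr; tabulate)
open import Data.List.Properties using (map-tabulate)
open import Data.Integer using (ℤ; _+_; _*_; 0ℤ; 1ℤ)
open import Data.Integer.Properties
  using (+-*-semiring; +-identityˡ; +-identityʳ; *-zeroˡ; *-zeroʳ; *-identityˡ)
open import Algebra.Properties.Semiring.Sum +-*-semiring
  using (sum; sum-syntax; sum-cong-≗; sum-replicate-zero; ∑-comm; *-distribˡ-sum; *-distribʳ-sum)
open import Data.Bool using (Bool; true; false; _∧_)
open import Data.Bool.Properties using (∧-comm)
open import Data.Product using (_×_; _,_)
open import Function using (id)
open import Level using (0ℓ)
open import Relation.Nullary using (does; yes; no; ¬_; contradiction; _×-dec_)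
open import Relation.Binary using (Rel; Decidable; IsPartialOrder)
open import Relation.Binary.Lattice.Structures using (IsMeetSemilattice; IsBoundedLattice)
open import Relation.Binary.PropositionalEquality
  using (_≡_; _≢_; refl; sym; trans; cong; module ≡-Reasoning)
open ≡-Reasoning

guard-∧ : ∀ p q v → [ p ∧ q ]· v ≡ [ p ]· [ q ]· v
guard-∧ true  q v = refl
guard-∧ false q v = refl

guard-comm : ∀ p q v → [ p ]· [ q ]· v ≡ [ q ]· [ p ]· v
guard-comm true  q     v = refl
guard-comm false true  v = refl
guard-comm false false v = refl

guard-zero : ∀ p → [ p ]· 0ℤ ≡ 0ℤ
guard-zero true  = refl
guard-zero false = refl

guard-one-* : ∀ p v → [ p ]· 1ℤ * v ≡ [ p ]· v
guard-one-* true  v = *-identityˡ v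
guard-one-* false v = *-zeroˡ v

guard-*ˡ : ∀ p u v → [ p ]· u * v ≡ [ p ]· (u * v)
guard-*ˡ true  u v = refl
guard-*ˡ false u v = *-zeroˡ v

*-guard : ∀ p u v → u * [ p ]· v ≡ [ p ]· (u * v)
*-guard true  u v = refl
*-guard false u v = *-zeroʳ u

guard-shuffle : ∀ p q r s v → [ p ]· [ s ]· [ q ∧ r ]· v ≡ [ p ∧ q ∧ r ∧ s ]· v
guard-shuffle false q     r     s v = refl
guard-shuffle true  false r     s v = guard-zero s
guard-shuffle true  true  false s v = guard-zero s
guard-shuffle true  true  true  s v = refl

does-≟-sym : ∀ {n} (x y : Fin n) → does (x ≟ y) ≡ does (y ≟ x)
does-≟-sym x y with x ≟ y | y ≟ x
... | yes _   | yes _   = refl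
... | no  _   | no  _   = refl
... | yes x≡y | no  y≢x = contradiction (sym x≡y) y≢x
... | no  x≢y | yes y≡x = contradiction (sym y≡x) x≢y

δ₃-≢ : ∀ {n} {x y : Fin n} z → x ≢ y → δ₃ x y z ≡ 0ℤ
δ₃-≢ {x = x} {y} z x≢y with x ≟ y
... | yes x≡y = contradiction x≡y x≢y
... | no  _   = refl

δ₃-diagˡ : ∀ {n} (x z : Fin n) → δ₃ x z z ≡ [ does (x ≟ z) ]· 1ℤ
δ₃-diagˡ x z with x ≟ z | z ≟ z
... | _     | no z≢z = contradiction refl z≢z
... | yes _ | yes _  = refl
... | no  _ | yes _  = refl

δ₃-diagʳ : ∀ {n} (x z : Fin n) → δ₃ x x z ≡ [ does (z ≟ x) ]· 1ℤ
δ₃-diagʳ x z with x ≟ x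
... | no x≢x = contradiction refl x≢x
... | yes _  = cong ([_]· 1ℤ) (does-≟-sym x z)

ΣFin≡∑ : ∀ n (f : Fin n → ℤ) → ΣFin n f ≡ ∑[ i < n ] f i
ΣFin≡∑ n f = trans (cong (foldr _+_ 0ℤ) (map-tabulate id f)) (foldr-tabulate n f)
  where
  foldr-tabulate : ∀ n (f : Fin n → ℤ) → foldr _+_ 0ℤ (tabulate f) ≡ sum f
  foldr-tabulate zero    f = refl
  foldr-tabulate (suc n) f = cong (f zero +_) (foldr-tabulate n (λ i → f (suc i)))

∑-zero : ∀ {n} {f : Fin n → ℤ} → (∀ i → f i ≡ 0ℤ) → sum f ≡ 0ℤ
∑-zero {n} f≗0 = trans (sum-cong-≗ f≗0) (sum-replicate-zero n)

∑-guard : ∀ {n} p (f : Fin n → ℤ) → [ p ]· sum f ≡ ∑[ i < n ] [ p ]· f i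
∑-guard true  f = refl
∑-guard {n} false f = sym (∑-zero {n} (λ _ → refl))

∑-≟ : ∀ {n} (c : Fin n) (f : Fin n → ℤ) → ∑[ i < n ] [ does (i ≟ c) ]· f i ≡ f c
∑-≟ {suc n} zero f = begin
  f zero + ∑[ i < n ] [ does (suc i ≟ zero) ]· f (suc i)
    ≡⟨ cong (f zero +_) (∑-zero {n} (λ _ → refl)) ⟩
  f zero + 0ℤ
    ≡⟨ +-identityʳ (f zero) ⟩
  f zero ∎
∑-≟ {suc n} (suc c) f = begin
  0ℤ + ∑[ i < n ] [ does (i ≟ c) ]· f (suc i)  ≡⟨ +-identityˡ _ ⟩
  ∑[ i < n ] [ does (i ≟ c) ]· f (suc i)       ≡⟨ ∑-≟ c (λ i → f (suc i)) ⟩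
  f (suc c)                                   ∎

∑-guarded-comm : ∀ {m n} (p : Fin m → Bool) (q : Fin n → Bool) (f : Fin m → Fin n → ℤ) →
  ∑[ i < m ] [ p i ]· (∑[ j < n ] [ q j ]· f i j) ≡
  ∑[ j < n ] [ q j ]· (∑[ i < m ] [ p i ]· f i j)
∑-guarded-comm {m} {n} p q f = begin
  ∑[ i < m ] [ p i ]· (∑[ j < n ] [ q j ]· f i j)
    ≡⟨ sum-cong-≗ (λ i → ∑-guard {n} (p i) _) ⟩
  ∑[ i < m ] ∑[ j < n ] [ p i ]· [ q j ]· f i j
    ≡⟨ sum-cong-≗ (λ i → sum-cong-≗ (λ j → guard-comm (p i) (q j) _)) ⟩
  ∑[ i < m ] ∑[ j < n ] [ q j ]· [ p i ]· f i j
    ≡⟨ ∑-comm {m} {n} _ ⟩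
  ∑[ j < n ] ∑[ i < m ] [ q j ]· [ p i ]· f i j
    ≡⟨ sum-cong-≗ (λ j → ∑-guard {m} (q j) _) ⟨
  ∑[ j < n ] [ q j ]· (∑[ i < m ] [ p i ]· f i j) ∎

module Möbius {n} {_⊑_ : Rel (Fin n) 0ℓ} (_⊑?_ : Decidable _⊑_)
             (⊑-po : IsPartialOrder _≡_ _⊑_)
             {J : Fin n → Fin n → Fin n → ℤ} (isJ : IsJ _⊑_ _⊑?_ J) where

  open IsPartialOrder ⊑-po using ()
    renaming (refl to ⊑-refl; trans to ⊑-trans; antisym to ⊑-antisym)
  open IsJ isJ

  _⊑ᵇ_ : Fin n → Fin n → Bool
  x ⊑ᵇ y = does (x ⊑? y)

  ⊑ᵇ-antisym : ∀ {x y} → y ⊑ x → x ⊑ᵇ y ≡ does (x ≟ y)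
  ⊑ᵇ-antisym {x} {y} y⊑x with x ⊑? y | x ≟ y
  ... | yes x⊑y | no  x≢y = contradiction (⊑-antisym x⊑y y⊑x) x≢y
  ... | no  x⋢y | yes refl = contradiction y⊑x x⋢y
  ... | yes _   | yes _   = refl
  ... | no  _   | no  _   = refl

  δ₃-incomparable : ∀ {x y z} → ¬ (x ⊑ y × y ⊑ z) → δ₃ x y z ≡ 0ℤ
  δ₃-incomparable {x} {y} {z} ¬x⊑y⊑z with x ≟ y | y ≟ z
  ... | yes refl | yes refl = contradiction (⊑-refl , ⊑-refl) ¬x⊑y⊑z
  ... | yes _    | no  _    = refl
  ... | no  _    | _        = refl

  J-support : ∀ x y z → J x y z ≡ [ x ⊑ᵇ y ∧ y ⊑ᵇ z ]· J x y z
  J-support x y z with x ⊑? y | y ⊑? z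
  ... | yes _   | yes _   = refl
  ... | yes _   | no  y⋢z = J-zero x y z (λ (_ , y⊑z) → y⋢z y⊑z)
  ... | no  x⋢y | _       = J-zero x y z (λ (x⊑y , _) → x⋢y x⊑y)

  interval-empty : ∀ {x y z} → ¬ (x ⊑ y × y ⊑ z) →
    ∀ a b → (x ⊑ᵇ a ∧ a ⊑ᵇ y ∧ y ⊑ᵇ b ∧ b ⊑ᵇ z) ≡ false
  interval-empty {x} {y} {z} ¬x⊑y⊑z a b with x ⊑? a | a ⊑? y | y ⊑? b | b ⊑? z
  ... | yes x⊑a | yes a⊑y | yes y⊑b | yes b⊑z =
        contradiction (⊑-trans x⊑a a⊑y , ⊑-trans y⊑b b⊑z) ¬x⊑y⊑z
  ... | no  _   | _       | _       | _       = refl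
  ... | yes _   | no  _   | _       | _       = refl
  ... | yes _   | yes _   | no  _   | _       = refl
  ... | yes _   | yes _   | yes _   | no  _   = refl

  J-sum-total : ∀ x y z →
    ∑[ a < n ] ∑[ b < n ] [ x ⊑ᵇ a ∧ a ⊑ᵇ y ∧ y ⊑ᵇ b ∧ b ⊑ᵇ z ]· J a y b ≡ δ₃ x y z
  J-sum-total x y z with (x ⊑? y) ×-dec (y ⊑? z)
  ... | yes (x⊑y , y⊑z) = begin
    ∑[ a < n ] ∑[ b < n ] [ x ⊑ᵇ a ∧ a ⊑ᵇ y ∧ y ⊑ᵇ b ∧ b ⊑ᵇ z ]· J a y b
      ≡⟨ sum-cong-≗ {n} (λ a → ΣFin≡∑ n _) ⟨
    ∑[ a < n ] ΣFin n (λ b → [ x ⊑ᵇ a ∧ a ⊑ᵇ y ∧ y ⊑ᵇ b ∧ b ⊑ᵇ z ]· J a y b)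
      ≡⟨ ΣFin≡∑ n _ ⟨
    ΣFin n (λ a → ΣFin n (λ b → [ x ⊑ᵇ a ∧ a ⊑ᵇ y ∧ y ⊑ᵇ b ∧ b ⊑ᵇ z ]· J a y b))
      ≡⟨ J-sum x y z x⊑y y⊑z ⟩
    δ₃ x y z ∎
  ... | no ¬x⊑y⊑z = trans
    (∑-zero {n} (λ a → ∑-zero {n} (λ b → cong ([_]· J a y b) (interval-empty ¬x⊑y⊑z a b))))
    (sym (δ₃-incomparable ¬x⊑y⊑z))

  J-sum-reduced : ∀ x y z → ∑[ a < n ] [ x ⊑ᵇ a ]· (∑[ b < n ] [ b ⊑ᵇ z ]· J a y b) ≡ δ₃ x y z
  J-sum-reduced x y z = begin
    ∑[ a < n ] [ x ⊑ᵇ a ]· (∑[ b < n ] [ b ⊑ᵇ z ]· J a y b)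
      ≡⟨ sum-cong-≗ {n} (λ a → ∑-guard {n} (x ⊑ᵇ a) _) ⟩
    ∑[ a < n ] ∑[ b < n ] [ x ⊑ᵇ a ]· [ b ⊑ᵇ z ]· J a y b
      ≡⟨ sum-cong-≗ {n} (λ a → sum-cong-≗ {n} (λ b → reshape a b)) ⟩
    ∑[ a < n ] ∑[ b < n ] [ x ⊑ᵇ a ∧ a ⊑ᵇ y ∧ y ⊑ᵇ b ∧ b ⊑ᵇ z ]· J a y b
      ≡⟨ J-sum-total x y z ⟩
    δ₃ x y z ∎
    where
    reshape : ∀ a b → [ x ⊑ᵇ a ]· [ b ⊑ᵇ z ]· J a y b
                    ≡ [ x ⊑ᵇ a ∧ a ⊑ᵇ y ∧ y ⊑ᵇ b ∧ b ⊑ᵇ z ]· J a y b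
    reshape a b = trans (cong (λ v → [ x ⊑ᵇ a ]· [ b ⊑ᵇ z ]· v) (J-support a y b))
                        (guard-shuffle (x ⊑ᵇ a) (a ⊑ᵇ y) (y ⊑ᵇ b) (b ⊑ᵇ z) (J a y b))

  J-diagˡ : ∀ x a b → [ x ⊑ᵇ a ]· J a x b ≡ [ does (a ≟ x) ]· J a x b
  J-diagˡ x a b with a ⊑? x
  ... | yes a⊑x = cong ([_]· J a x b) (trans (⊑ᵇ-antisym a⊑x) (does-≟-sym x a))
  ... | no  a⋢x rewrite J-zero a x b (λ (a⊑x , _) → a⋢x a⊑x) =
        trans (guard-zero (x ⊑ᵇ a)) (sym (guard-zero (does (a ≟ x))))

  J-diagʳ : ∀ a z b → [ b ⊑ᵇ z ]· J a z b ≡ [ does (b ≟ z) ]· J a z b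
  J-diagʳ a z b with z ⊑? b
  ... | yes z⊑b = cong ([_]· J a z b) (⊑ᵇ-antisym z⊑b)
  ... | no  z⋢b rewrite J-zero a z b (λ (_ , z⊑b) → z⋢b z⊑b) =
        trans (guard-zero (b ⊑ᵇ z)) (sym (guard-zero (does (b ≟ z))))

  möbiusʳ : ∀ x z → ∑[ b < n ] [ b ⊑ᵇ z ]· J x x b ≡ δ₃ x x z
  möbiusʳ x z = begin
    ∑[ b < n ] [ b ⊑ᵇ z ]· J x x b
      ≡⟨ sum-cong-≗ {n} (λ b → cong ([ b ⊑ᵇ z ]·_) (∑-≟ x (λ a → J a x b))) ⟨
    ∑[ b < n ] [ b ⊑ᵇ z ]· (∑[ a < n ] [ does (a ≟ x) ]· J a x b)
      ≡⟨ sum-cong-≗ {n} (λ b → cong ([ b ⊑ᵇ z ]·_) (sum-cong-≗ {n} (λ a → J-diagˡ x a b))) ⟨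
    ∑[ b < n ] [ b ⊑ᵇ z ]· (∑[ a < n ] [ x ⊑ᵇ a ]· J a x b)
      ≡⟨ ∑-guarded-comm (x ⊑ᵇ_) (_⊑ᵇ z) (λ a b → J a x b) ⟨
    ∑[ a < n ] [ x ⊑ᵇ a ]· (∑[ b < n ] [ b ⊑ᵇ z ]· J a x b)
      ≡⟨ J-sum-reduced x x z ⟩
    δ₃ x x z ∎

  möbiusˡ : ∀ x z → ∑[ a < n ] [ x ⊑ᵇ a ]· J a z z ≡ δ₃ x z z
  möbiusˡ x z = begin
    ∑[ a < n ] [ x ⊑ᵇ a ]· J a z z
      ≡⟨ sum-cong-≗ {n} (λ a → cong ([ x ⊑ᵇ a ]·_) (∑-≟ z (J a z))) ⟨
    ∑[ a < n ] [ x ⊑ᵇ a ]· (∑[ b < n ] [ does (b ≟ z) ]· J a z b)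
      ≡⟨ sum-cong-≗ {n} (λ a → cong ([ x ⊑ᵇ a ]·_) (sum-cong-≗ {n} (J-diagʳ a z))) ⟨
    ∑[ a < n ] [ x ⊑ᵇ a ]· (∑[ b < n ] [ b ⊑ᵇ z ]· J a z b)
      ≡⟨ J-sum-reduced x z z ⟩
    δ₃ x z z ∎

  möbius-inversion : ∀ (g : Fin n → ℤ) z →
    g z ≡ ∑[ w < n ] (J w z z * ∑[ c < n ] [ c ⊑ᵇ w ]· g c)
  möbius-inversion g z = begin
    g z
      ≡⟨ ∑-≟ z g ⟨
    ∑[ c < n ] [ does (c ≟ z) ]· g c
      ≡⟨ sum-cong-≗ {n} (λ c → trans (cong (_* g c) (δ₃-diagˡ c z)) (guard-one-* _ (g c))) ⟨
    ∑[ c < n ] (δ₃ c z z * g c)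
      ≡⟨ sum-cong-≗ {n} (λ c → cong (_* g c) (möbiusˡ c z)) ⟨
    ∑[ c < n ] ((∑[ w < n ] [ c ⊑ᵇ w ]· J w z z) * g c)
      ≡⟨ sum-cong-≗ {n} (λ c → *-distribʳ-sum {n} (g c) _) ⟩
    ∑[ c < n ] ∑[ w < n ] ([ c ⊑ᵇ w ]· J w z z * g c)
      ≡⟨ sum-cong-≗ {n} (λ c → sum-cong-≗ {n} (λ w → guard-*ˡ (c ⊑ᵇ w) (J w z z) (g c))) ⟩
    ∑[ c < n ] ∑[ w < n ] [ c ⊑ᵇ w ]· (J w z z * g c)
      ≡⟨ ∑-comm {n} {n} _ ⟩
    ∑[ w < n ] ∑[ c < n ] [ c ⊑ᵇ w ]· (J w z z * g c)
      ≡⟨ sum-cong-≗ {n} (λ w → sum-cong-≗ {n} (λ c → *-guard (c ⊑ᵇ w) (J w z z) (g c))) ⟨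
    ∑[ w < n ] ∑[ c < n ] (J w z z * [ c ⊑ᵇ w ]· g c)
      ≡⟨ sum-cong-≗ {n} (λ w → *-distribˡ-sum {n} (J w z z) _) ⟨
    ∑[ w < n ] (J w z z * ∑[ c < n ] [ c ⊑ᵇ w ]· g c) ∎

module MeetFibre {n} {_⊑_ : Rel (Fin n) 0ℓ} (_⊑?_ : Decidable _⊑_)
                 {_⊓_ : Fin n → Fin n → Fin n} (⊓-meet : IsMeetSemilattice _≡_ _⊑_ _⊓_)
                 {J : Fin n → Fin n → Fin n → ℤ} (isJ : IsJ _⊑_ _⊑?_ J)
                 (c : Fin n) {a b : Fin n} (a⊑b : a ⊑ b) (a≢b : a ≢ b) where

  open IsMeetSemilattice ⊓-meet using (isPartialOrder; x∧y≤x; x∧y≤y; ∧-greatest)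
    renaming (antisym to ⊑-antisym; trans to ⊑-trans)
  open Möbius _⊑?_ isPartialOrder isJ

  ⊑ᵇ-⊓ : ∀ y x → y ⊑ᵇ (x ⊓ a) ≡ y ⊑ᵇ x ∧ y ⊑ᵇ a
  ⊑ᵇ-⊓ y x with y ⊑? (x ⊓ a) | y ⊑? x | y ⊑? a
  ... | yes _     | yes _   | yes _   = refl
  ... | yes y⊑x⊓a | no  y⋢x | _       = contradiction (⊑-trans y⊑x⊓a (x∧y≤x x a)) y⋢x
  ... | yes y⊑x⊓a | yes _   | no  y⋢a = contradiction (⊑-trans y⊑x⊓a (x∧y≤y x a)) y⋢a
  ... | no  y⋢x⊓a | yes y⊑x | yes y⊑a = contradiction (∧-greatest y⊑x y⊑a) y⋢x⊓a
  ... | no  _     | yes _   | no  _   = refl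
  ... | no  _     | no  _   | _       = refl

  δ₃-below-a≡0 : ∀ y w → [ y ⊑ᵇ a ]· δ₃ y b w ≡ 0ℤ
  δ₃-below-a≡0 y w with y ⊑? a
  ... | yes y⊑a = δ₃-≢ {x = y} {b} w (λ { refl → a≢b (⊑-antisym a⊑b y⊑a) })
  ... | no  _   = refl

  fibre : Fin n → ℤ
  fibre z = ∑[ x < n ] [ does ((x ⊓ a) ≟ c) ]· J x b z

  fibre-indicator : ∀ x v → [ does ((x ⊓ a) ≟ c) ]· v ≡ (∑[ y < n ] [ y ⊑ᵇ (x ⊓ a) ]· J c c y) * v
  fibre-indicator x v = begin
    [ does ((x ⊓ a) ≟ c) ]· v                 ≡⟨ guard-one-* _ v ⟨
    [ does ((x ⊓ a) ≟ c) ]· 1ℤ * v            ≡⟨ cong (_* v) (δ₃-diagʳ c (x ⊓ a)) ⟨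
    δ₃ c c (x ⊓ a) * v                       ≡⟨ cong (_* v) (möbiusʳ c (x ⊓ a)) ⟨
    (∑[ y < n ] [ y ⊑ᵇ (x ⊓ a) ]· J c c y) * v ∎

  ∑-fibre-down≡0 : ∀ w → ∑[ z < n ] [ z ⊑ᵇ w ]· fibre z ≡ 0ℤ
  ∑-fibre-down≡0 w = begin
    ∑[ z < n ] [ z ⊑ᵇ w ]· fibre z
      ≡⟨ ∑-guarded-comm (λ x → does ((x ⊓ a) ≟ c)) (_⊑ᵇ w) (λ x z → J x b z) ⟨
    ∑[ x < n ] [ does ((x ⊓ a) ≟ c) ]· I x
      ≡⟨ sum-cong-≗ {n} (λ x → fibre-indicator x (I x)) ⟩
    ∑[ x < n ] ((∑[ y < n ] [ y ⊑ᵇ (x ⊓ a) ]· μ y) * I x)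
      ≡⟨ sum-cong-≗ {n} (λ x → *-distribʳ-sum {n} (I x) _) ⟩
    ∑[ x < n ] ∑[ y < n ] ([ y ⊑ᵇ (x ⊓ a) ]· μ y * I x)
      ≡⟨ ∑-comm {n} {n} _ ⟩
    ∑[ y < n ] ∑[ x < n ] ([ y ⊑ᵇ (x ⊓ a) ]· μ y * I x)
      ≡⟨ ∑-zero {n} ∑-over-x ⟩
    0ℤ ∎
    where
    μ : Fin n → ℤ
    μ y = J c c y

    I : Fin n → ℤ
    I x = ∑[ z < n ] [ z ⊑ᵇ w ]· J x b z

    regroup : ∀ y x → [ y ⊑ᵇ (x ⊓ a) ]· μ y * I x ≡ [ y ⊑ᵇ a ]· (μ y * [ y ⊑ᵇ x ]· I x)
    regroup y x = begin
      [ y ⊑ᵇ (x ⊓ a) ]· μ y * I x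
        ≡⟨ guard-*ˡ (y ⊑ᵇ (x ⊓ a)) (μ y) (I x) ⟩
      [ y ⊑ᵇ (x ⊓ a) ]· (μ y * I x)
        ≡⟨ cong ([_]· (μ y * I x)) (trans (⊑ᵇ-⊓ y x) (∧-comm (y ⊑ᵇ x) (y ⊑ᵇ a))) ⟩
      [ y ⊑ᵇ a ∧ y ⊑ᵇ x ]· (μ y * I x)
        ≡⟨ guard-∧ (y ⊑ᵇ a) (y ⊑ᵇ x) _ ⟩
      [ y ⊑ᵇ a ]· [ y ⊑ᵇ x ]· (μ y * I x)
        ≡⟨ cong ([ y ⊑ᵇ a ]·_) (*-guard (y ⊑ᵇ x) (μ y) (I x)) ⟨
      [ y ⊑ᵇ a ]· (μ y * [ y ⊑ᵇ x ]· I x) ∎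

    ∑-over-x : ∀ y → ∑[ x < n ] ([ y ⊑ᵇ (x ⊓ a) ]· μ y * I x) ≡ 0ℤ
    ∑-over-x y = begin
      ∑[ x < n ] ([ y ⊑ᵇ (x ⊓ a) ]· μ y * I x)
        ≡⟨ sum-cong-≗ {n} (regroup y) ⟩
      ∑[ x < n ] [ y ⊑ᵇ a ]· (μ y * [ y ⊑ᵇ x ]· I x)
        ≡⟨ ∑-guard {n} (y ⊑ᵇ a) _ ⟨
      [ y ⊑ᵇ a ]· (∑[ x < n ] (μ y * [ y ⊑ᵇ x ]· I x))
        ≡⟨ cong ([ y ⊑ᵇ a ]·_) (*-distribˡ-sum {n} (μ y) _) ⟨
      [ y ⊑ᵇ a ]· (μ y * ∑[ x < n ] [ y ⊑ᵇ x ]· I x)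
        ≡⟨ cong (λ t → [ y ⊑ᵇ a ]· (μ y * t)) (J-sum-reduced y b w) ⟩
      [ y ⊑ᵇ a ]· (μ y * δ₃ y b w)
        ≡⟨ *-guard (y ⊑ᵇ a) (μ y) _ ⟨
      μ y * [ y ⊑ᵇ a ]· δ₃ y b w
        ≡⟨ cong (μ y *_) (δ₃-below-a≡0 y w) ⟩
      μ y * 0ℤ
        ≡⟨ *-zeroʳ (μ y) ⟩
      0ℤ ∎

  fibre≡0 : ∀ z → fibre z ≡ 0ℤ
  fibre≡0 z = begin
    fibre z
      ≡⟨ möbius-inversion fibre z ⟩
    ∑[ w < n ] (J w z z * ∑[ x < n ] [ x ⊑ᵇ w ]· fibre x)
      ≡⟨ sum-cong-≗ {n} (λ w → cong (J w z z *_) (∑-fibre-down≡0 w)) ⟩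
    ∑[ w < n ] (J w z z * 0ℤ)
      ≡⟨ ∑-zero {n} (λ w → *-zeroʳ (J w z z)) ⟩
    0ℤ ∎

-- Only the meet and the strict inequality a ⊏ b are needed: 𝟘 and 𝟙 play the
-- roles of arbitrary c and z.
theorem5p10 : (n : ℕ) → 3 ≤ n →
    (_⊑_ : Rel (Fin n) _) → (_⊑?_ : Decidable _⊑_) →
    (_∨_ _∧_ : Fin n → Fin n → Fin n) → (𝟙 𝟘 : Fin n) →
    IsBoundedLattice _≡_ _⊑_ _∨_ _∧_ 𝟙 𝟘 →
    (J : Fin n → Fin n → Fin n → ℤ) → IsJ _⊑_ _⊑?_ J →
    (a b : Fin n) → (𝟘 ⊑ a × 𝟘 ≢ a) → (a ⊑ b × a ≢ b) →
    ΣFin n (λ x → [ does ((x ∧ a) ≟ 𝟘) ]· J x b 𝟙) ≡ 0ℤ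
theorem5p10 n _ _⊑_ _⊑?_ _∨_ _∧_ 𝟙 𝟘 L J isJ a b _ (a⊑b , a≢b) =
  trans (ΣFin≡∑ n _) (fibre≡0 𝟙)
  where open MeetFibre _⊑?_ (IsBoundedLattice.isMeetSemilattice L) isJ 𝟘 a⊑b a≢b
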